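{- Let $\mathcal{C}\subseteq\mathbb{Q}_+^N$ be a rational polyhedral cone (the set of rational points of a cone defined by finitely many linear inequalities with rational coefficients). Then $\mathcal{C}$ is closed under componentwise maximum $\oplus$ if and only if $\mathcal{C}\cap\mathbb{Z}^N$ is closed under $\oplus$.
   Context: $N$ is a finite set; $\mathbb{Q}_+$ denotes the nonnegative rationals. For vectors $u,v$, $u\oplus v$ is the componentwise maximum: $(u\oplus v)_i=\max(u_i,v_i)$. -}

module Defs where

open import Data.Nat using (ℕ; zero; suc)
open import Data.Fin using (Fin; zero; suc)
open import Data.Integer using (ℤ)
open import Data.Rational using (ℚ; 0ℚ; _+_; _*_; _≤_; _⊔_; _/_)
open import Data.Product using (∃; _×_)
open import Relation.Binary.PropositionalEquality using (_≡_)

sumℚ : (n : ℕ) → (Fin n → ℚ) → ℚ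
sumℚ zero    f = 0ℚ
sumℚ (suc n) f = f zero + sumℚ n (λ i → f (suc i))

dot : {n : ℕ} → (Fin n → ℚ) → (Fin n → ℚ) → ℚ
dot {n} a x = sumℚ n (λ i → a i * x i)

_⊕_ : {n : ℕ} → (Fin n → ℚ) → (Fin n → ℚ) → (Fin n → ℚ)
(u ⊕ v) i = u i ⊔ v i

Subsetℚ : ℕ → Set₁
Subsetℚ n = (Fin n → ℚ) → Set

-- The rational polyhedral cone in ℚ_+^N cut out by the m homogeneous
-- linear inequalities  Σ_i A j i * x i ≥ 0  (j : Fin m) with rational
-- coefficients, intersected with the nonnegative orthant.
PolyCone : {n m : ℕ} → (Fin m → Fin n → ℚ) → Subsetℚ n
PolyCone {n} {m} A x = ((i : Fin n) → 0ℚ ≤ x i) × ((j : Fin m) → 0ℚ ≤ dot (A j) x)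

IsInt : ℚ → Set
IsInt q = ∃ λ (z : ℤ) → q ≡ z / 1

IntPoint : {n : ℕ} → Subsetℚ n
IntPoint {n} x = (i : Fin n) → IsInt (x i)

_∩ℤ : {n : ℕ} → Subsetℚ n → Subsetℚ n
(S ∩ℤ) x = S x × IntPoint x

Closed⊕ : {n : ℕ} → Subsetℚ n → Set
Closed⊕ S = ∀ x y → S x → S y → S (x ⊕ y)

-- Integer points are closed under ⊕ because max of two integers is one of them.
-- Conversely, given rational points x, y of a cone, scale both by a positive
-- integer D clearing all their denominators: D·x and D·y are integer points of
-- the cone, so D·x ⊕ D·y lies in it, and since scaling by D ≥ 0 commutes with
-- ⊕, dividing by D gives x ⊕ y. Polyhedrality is irrelevant: the argument works
-- for every cone in ℚ^N.
module Submission where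

open import Defs
open import Data.Nat using (ℕ; zero; suc)
import Data.Nat as ℕ
import Data.Nat.Properties as ℕ
open import Data.Fin using (Fin; zero; suc)
open import Data.Integer using (+_)
import Data.Integer as ℤ
import Data.Integer.Properties as ℤ
open import Data.Rational
  using (ℚ; mkℚ; ↥_; ↧_; 0ℚ; 1ℚ; _+_; _*_; _≤_; _⊔_; _/_; 1/_; Positive; NonZero; toℚᵘ; fromℚᵘ; nonNegative)
open import Data.Rational.Properties
import Data.Rational.Unnormalised as ℚᵘ
import Data.Rational.Unnormalised.Properties as ℚᵘ
open import Algebra.Bundles using (CommutativeMonoid)
open import Algebra.Properties.CommutativeSemigroup
  (CommutativeMonoid.commutativeSemigroup *-1-commutativeMonoid) using (xy∙z≈y∙xz; x∙yz≈y∙xz)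
open import Data.Product using (_×_; _,_; proj₁)
open import Data.Sum using (inj₁; inj₂)
open import Function using (_∘_)
open import Relation.Binary.Definitions using (_Respects_)
open import Relation.Binary.PropositionalEquality

fromℚᵘ-homo-* : ∀ p q → fromℚᵘ (p ℚᵘ.* q) ≡ fromℚᵘ p * fromℚᵘ q
fromℚᵘ-homo-* p q = toℚᵘ-injective (begin
  toℚᵘ (fromℚᵘ (p ℚᵘ.* q))              ≈⟨ toℚᵘ-fromℚᵘ (p ℚᵘ.* q) ⟩
  p ℚᵘ.* q                              ≈⟨ ℚᵘ.*-cong (toℚᵘ-fromℚᵘ p) (toℚᵘ-fromℚᵘ q) ⟨
  toℚᵘ (fromℚᵘ p) ℚᵘ.* toℚᵘ (fromℚᵘ q)  ≈⟨ toℚᵘ-homo-* (fromℚᵘ p) (fromℚᵘ q) ⟨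
  toℚᵘ (fromℚᵘ p * fromℚᵘ q)            ∎)
  where open ℚᵘ.≃-Reasoning

↧p*p≡↥p : ∀ p → (↧ p / 1) * p ≡ ↥ p / 1
↧p*p≡↥p p@(mkℚ n d _) = begin
  (↧ p / 1) * p                         ≡⟨ cong ((↧ p / 1) *_) (fromℚᵘ-toℚᵘ p) ⟨
  (↧ p / 1) * fromℚᵘ (toℚᵘ p)           ≡⟨ fromℚᵘ-homo-* ↧pᵘ (toℚᵘ p) ⟨
  fromℚᵘ (↧pᵘ ℚᵘ.* ℚᵘ.mkℚᵘ n d)         ≡⟨ fromℚᵘ-cong {↧pᵘ ℚᵘ.* ℚᵘ.mkℚᵘ n d} {ℚᵘ.mkℚᵘ n 0} (ℚᵘ.*≡* cross) ⟩
  ↥ p / 1                               ∎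
  where
  open ≡-Reasoning
  ↧pᵘ : ℚᵘ.ℚᵘ
  ↧pᵘ = ℚᵘ.mkℚᵘ (↧ p) 0
  cross : (↧ p ℤ.* n) ℤ.* + 1 ≡ n ℤ.* + (1 ℕ.* suc d)
  cross = begin
    (↧ p ℤ.* n) ℤ.* + 1  ≡⟨ ℤ.*-identityʳ _ ⟩
    ↧ p ℤ.* n            ≡⟨ ℤ.*-comm (↧ p) n ⟩
    n ℤ.* + suc d        ≡⟨ cong (λ k → n ℤ.* + k) (ℕ.*-identityˡ (suc d)) ⟨
    n ℤ.* + (1 ℕ.* suc d) ∎

-- z / 1 unfolds to fromℚᵘ (mkℚᵘ z 0), and mkℚᵘ a 0 ℚᵘ.* mkℚᵘ b 0 to mkℚᵘ (a ℤ.* b) 0.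
IsInt-* : ∀ {p q} → IsInt p → IsInt q → IsInt (p * q)
IsInt-* (a , refl) (b , refl) = a ℤ.* b , sym (fromℚᵘ-homo-* (ℚᵘ.mkℚᵘ a 0) (ℚᵘ.mkℚᵘ b 0))

IsInt-⊔ : ∀ {p q} → IsInt p → IsInt q → IsInt (p ⊔ q)
IsInt-⊔ {p} {q} p∈ℤ q∈ℤ with ⊔-sel p q
... | inj₁ p⊔q≡p = subst IsInt (sym p⊔q≡p) p∈ℤ
... | inj₂ p⊔q≡q = subst IsInt (sym p⊔q≡q) q∈ℤ

infixr 7 _·_
_·_ : ∀ {n} → ℚ → (Fin n → ℚ) → (Fin n → ℚ)
(c · x) i = c * x i

commonDenominator : ∀ {n} → (Fin n → ℚ) → ℚ
commonDenominator {zero}  x = 1ℚ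
commonDenominator {suc n} x = (↧ (x zero) / 1) * commonDenominator (x ∘ suc)

commonDenominator-pos : ∀ {n} (x : Fin n → ℚ) → Positive (commonDenominator x)
commonDenominator-pos {zero}  x = _
commonDenominator-pos {suc n} x with x zero
... | mkℚ _ d _ = pos*pos⇒pos (+ suc d / 1) {{normalize-pos (suc d) 1}} _
                    {{commonDenominator-pos (x ∘ suc)}}

commonDenominator-isInt : ∀ {n} (x : Fin n → ℚ) → IsInt (commonDenominator x)
commonDenominator-isInt {zero}  x = + 1 , refl
commonDenominator-isInt {suc n} x = IsInt-* (↧ (x zero) , refl) (commonDenominator-isInt (x ∘ suc))

commonDenominator-clears : ∀ {n} (x : Fin n → ℚ) → IntPoint (commonDenominator x · x)
commonDenominator-clears {suc n} x zero =
  subst IsInt (sym (xy∙z≈y∙xz (↧ (x zero) / 1) (commonDenominator (x ∘ suc)) (x zero)))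
    (IsInt-* (commonDenominator-isInt (x ∘ suc)) (↥ (x zero) , ↧p*p≡↥p (x zero)))
commonDenominator-clears {suc n} x (suc i) =
  subst IsInt (sym (*-assoc (↧ (x zero) / 1) (commonDenominator (x ∘ suc)) (x (suc i))))
    (IsInt-* (↧ (x zero) , refl) (commonDenominator-clears (x ∘ suc) i))

IsCone : ∀ {n} → Subsetℚ n → Set
IsCone S = ∀ c x → 0ℚ ≤ c → S x → S (c · x)

Closed⊕⇒Closed⊕-∩ℤ : ∀ {n} (S : Subsetℚ n) → Closed⊕ S → Closed⊕ (S ∩ℤ)
Closed⊕⇒Closed⊕-∩ℤ S closed x y (x∈S , x∈ℤ) (y∈S , y∈ℤ) =
  closed x y x∈S y∈S , λ i → IsInt-⊔ (x∈ℤ i) (y∈ℤ i)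

Closed⊕-∩ℤ⇒Closed⊕ : ∀ {n} (S : Subsetℚ n) → IsCone S → S Respects _≗_ →
                     Closed⊕ (S ∩ℤ) → Closed⊕ S
Closed⊕-∩ℤ⇒Closed⊕ S cone resp closed x y x∈S y∈S =
  resp unscale (cone (1/ D) _ (nonNegative⁻¹ (1/ D) {{pos⇒nonNeg (1/ D) {{1/pos⇒pos D}}}})
    (proj₁ (closed (D · x) (D · y) (cone D x D≥0 x∈S , Dx∈ℤ) (cone D y D≥0 y∈S , Dy∈ℤ))))
  where
  dx dy D : ℚ
  dx = commonDenominator x
  dy = commonDenominator y
  D  = dx * dy
  instance
    D>0 : Positive D
    D>0 = pos*pos⇒pos dx {{commonDenominator-pos x}} dy {{commonDenominator-pos y}}
    D≢0 : NonZero D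
    D≢0 = pos⇒nonZero D
  D≥0 : 0ℚ ≤ D
  D≥0 = nonNegative⁻¹ D {{pos⇒nonNeg D}}
  Dx∈ℤ : IntPoint (D · x)
  Dx∈ℤ i = subst IsInt (sym (xy∙z≈y∙xz dx dy (x i)))
             (IsInt-* (commonDenominator-isInt y) (commonDenominator-clears x i))
  Dy∈ℤ : IntPoint (D · y)
  Dy∈ℤ i = subst IsInt (sym (*-assoc dx dy (y i)))
             (IsInt-* (commonDenominator-isInt x) (commonDenominator-clears y i))
  unscale : 1/ D · ((D · x) ⊕ (D · y)) ≗ x ⊕ y
  unscale i = begin
    1/ D * (D * x i ⊔ D * y i)  ≡⟨ cong (1/ D *_) (*-distribˡ-⊔-nonNeg D {{pos⇒nonNeg D}} (x i) (y i)) ⟨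
    1/ D * (D * (x i ⊔ y i))    ≡⟨ *-assoc (1/ D) D (x i ⊔ y i) ⟨
    1/ D * D * (x i ⊔ y i)      ≡⟨ cong (_* (x i ⊔ y i)) (*-inverseˡ D) ⟩
    1ℚ * (x i ⊔ y i)            ≡⟨ *-identityˡ (x i ⊔ y i) ⟩
    x i ⊔ y i                   ∎
    where open ≡-Reasoning

sumℚ-cong : ∀ n {f g : Fin n → ℚ} → f ≗ g → sumℚ n f ≡ sumℚ n g
sumℚ-cong zero    f≗g = refl
sumℚ-cong (suc n) f≗g = cong₂ _+_ (f≗g zero) (sumℚ-cong n (f≗g ∘ suc))

sumℚ-*ˡ : ∀ n c (f : Fin n → ℚ) → sumℚ n (c · f) ≡ c * sumℚ n f
sumℚ-*ˡ zero    c f = sym (*-zeroʳ c)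
sumℚ-*ˡ (suc n) c f = begin
  c * f zero + sumℚ n (c · (f ∘ suc))  ≡⟨ cong (λ s → c * f zero + s) (sumℚ-*ˡ n c (f ∘ suc)) ⟩
  c * f zero + c * sumℚ n (f ∘ suc)    ≡⟨ *-distribˡ-+ c (f zero) _ ⟨
  c * sumℚ (suc n) f                   ∎
  where open ≡-Reasoning

dot-congʳ : ∀ {n} (a : Fin n → ℚ) {x y : Fin n → ℚ} → x ≗ y → dot a x ≡ dot a y
dot-congʳ {n} a x≗y = sumℚ-cong n (λ i → cong (a i *_) (x≗y i))

dot-·ʳ : ∀ {n} (a : Fin n → ℚ) c (x : Fin n → ℚ) → dot a (c · x) ≡ c * dot a x
dot-·ʳ {n} a c x = trans (sumℚ-cong n (λ i → x∙yz≈y∙xz (a i) c (x i))) (sumℚ-*ˡ n c _)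

PolyCone-isCone : ∀ {n m} (A : Fin m → Fin n → ℚ) → IsCone (PolyCone A)
PolyCone-isCone A c x c≥0 (x≥0 , Ax≥0) =
  (λ i → *-nonNeg c≥0 (x≥0 i)) ,
  (λ j → subst (0ℚ ≤_) (sym (dot-·ʳ (A j) c x)) (*-nonNeg c≥0 (Ax≥0 j)))
  where
  *-nonNeg : ∀ {p q} → 0ℚ ≤ p → 0ℚ ≤ q → 0ℚ ≤ p * q
  *-nonNeg {p} {q} p≥0 q≥0 = nonNegative⁻¹ (p * q)
    {{nonNeg*nonNeg⇒nonNeg p {{nonNegative p≥0}} q {{nonNegative q≥0}}}}

PolyCone-respects-≗ : ∀ {n m} (A : Fin m → Fin n → ℚ) → PolyCone A Respects _≗_
PolyCone-respects-≗ A x≗y (x≥0 , Ax≥0) =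
  (λ i → subst (0ℚ ≤_) (x≗y i) (x≥0 i)) ,
  (λ j → subst (0ℚ ≤_) (dot-congʳ (A j) x≗y) (Ax≥0 j))

mainTheorem11 : (n m : ℕ) (A : Fin m → Fin n → ℚ) →
    (Closed⊕ (PolyCone A) → Closed⊕ (PolyCone A ∩ℤ)) × (Closed⊕ (PolyCone A ∩ℤ) → Closed⊕ (PolyCone A))
mainTheorem11 n m A =
  Closed⊕⇒Closed⊕-∩ℤ (PolyCone A) ,
  Closed⊕-∩ℤ⇒Closed⊕ (PolyCone A) (PolyCone-isCone A) (PolyCone-respects-≗ A)
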